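{- For $n\ge1$, $E_n$ is a normal subgroup of $\mathrm{Aut}(T_n)$ if and only if $n = 1$ or $n=2$.
   Context: $T_n$ is the regular ternary rooted tree with $n$ levels: vertices at level $i$ are sequences $(\ell_1,\dots,\ell_i)$ with $\ell_j\in\{1,2,3\}$, and $(\ell_1,\dots,\ell_i)$ is joined to $(\ell_1,\dots,\ell_{i+1})$. $\mathrm{Aut}(T_n)$ is identified with $\mathrm{Aut}(T_{n-1})\wr\mathrm{Aut}(T_1)$: $((a_1,a_2,a_3),b)$ sends $(i,\ell_2,\dots,\ell_k)$ to $(b(i),a_i(\ell_2,\dots,\ell_k))$. $\mathrm{sgn}_2(\sigma)$ is the sign of the permutation induced by $\sigma$ on the 9 vertices of level $2$. Define $E_1=\mathrm{Aut}(T_1)\cong\mathfrak S_3$ and, for $n\ge2$, $E_n=\{\sigma=((a_1,a_2,a_3),b)\in\mathrm{Aut}(T_n): a_1,a_2,a_3\in E_{n-1},\ \mathrm{sgn}_2(\sigma)=1\}$. -}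

module Defs where

open import Data.Nat using (ℕ; zero; suc; _+_; _%_; _≡ᵇ_)
open import Data.Bool using (Bool; true; false; if_then_else_; _∧_)
open import Data.Fin using (Fin; _<?_; combine)
open import Data.Fin.Permutation using (Permutation′; _⟨$⟩ʳ_; _∘ₚ_; flip)
import Data.Fin.Permutation as P
open import Data.List using (List; map; allFin)
open import Data.Nat.ListAction using (sum)
open import Data.Product using (_×_; _,_; proj₁; proj₂)
open import Data.Unit using (⊤; tt)
open import Data.Sign using (Sign) renaming (+ to plus; - to minus)
open import Relation.Nullary.Decidable using (⌊_⌋)
open import Relation.Binary.PropositionalEquality using (_≡_)

-- Aut(T_n), via the wreath recursion Aut(T_n) = Aut(T_{n-1}) ≀ S_3.
-- An element of Aut (suc n) is ((a_1,a_2,a_3), b), a : Fin 3 → Aut n, b ∈ S_3.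
Aut : ℕ → Set
Aut zero    = ⊤
Aut (suc n) = (Fin 3 → Aut n) × Permutation′ 3

act : {n : ℕ} → Aut n → List (Fin 3) → List (Fin 3)
act {zero}  _       l          = l
act {suc n} (a , b) List.[]    = List.[]
act {suc n} (a , b) (i List.∷ l) = (b ⟨$⟩ʳ i) List.∷ act (a i) l

-- group structure (composition of maps: (σ · τ)(x) = σ(τ(x)))
infixl 7 _·_
_·_ : {n : ℕ} → Aut n → Aut n → Aut n
_·_ {zero}  _       _       = tt
_·_ {suc n} (a , b) (c , d) = (λ i → a (d ⟨$⟩ʳ i) · c i) , (d ∘ₚ b)

idA : {n : ℕ} → Aut n
idA {zero}  = tt
idA {suc n} = (λ _ → idA) , P.id

inv : {n : ℕ} → Aut n → Aut n
inv {zero}  _       = tt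
inv {suc n} (a , b) = (λ i → inv (a (flip b ⟨$⟩ʳ i))) , flip b

inversions : (m : ℕ) → (Fin m → Fin m) → ℕ
inversions m f =
  sum (map (λ i → sum (map (λ j → if ⌊ i <? j ⌋ ∧ ⌊ f j <? f i ⌋ then 1 else 0)
                           (allFin m)))
           (allFin m))

sign : (m : ℕ) → (Fin m → Fin m) → Sign
sign m f = if inversions m f % 2 ≡ᵇ 0 then plus else minus

level2 : {n : ℕ} → Aut (suc (suc n)) → Fin 3 → Fin 3 → Fin 9
level2 (a , b) i j = combine (b ⟨$⟩ʳ i) (proj₂ (a i) ⟨$⟩ʳ j)

sgn₂ : {n : ℕ} → Aut (suc (suc n)) → Sign
sgn₂ σ = sign 9 (λ x → let (i , j) = Data.Fin.remQuot 3 x in level2 σ i j)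

-- E_n (E_0 is not used; set to everything)
E : (n : ℕ) → Aut n → Set
E zero          _         = ⊤
E (suc zero)    _         = ⊤
E (suc (suc n)) σ@(a , b) = ((i : Fin 3) → E (suc n) (a i)) × (sgn₂ σ ≡ plus)

record IsNormalSubgroup (n : ℕ) (H : Aut n → Set) : Set where
  field
    has-id   : H idA
    ·-closed : (σ τ : Aut n) → H σ → H τ → H (σ · τ)
    inv-closed : (σ : Aut n) → H σ → H (inv σ)
    conj-closed : (g σ : Aut n) → H σ → H (g · σ · inv g)

-- Writing σ = ((a₁,a₂,a₃),b), the permutation σ induces on level 2 is a wreath product element, so
-- sgn₂ σ = sgn(b)³ · ∏ sgn(top aᵢ) = sgn(b) · ∏ sgn(top aᵢ); this only involves four elements of
-- S₃ and is checked by running through S₃⁴, and the right-hand side is visibly a homomorphism to {±1}. Hence sgn₂ is a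
-- homomorphism on every Aut(T_n), and E₂ is its kernel, a normal subgroup.
-- For n = 3, let σ ∈ E₃ have root permutation swapping the first two subtrees and let g act as
-- some x below the first child only. Then the first section of gσg⁻¹ is (a section of σ)·x⁻¹,
-- which leaves E₂ when x is odd on level 2. Placing σ below two children and g below one
-- propagates such a counterexample from E_n to E_{n+1}.

module Submission where

open import Defs
open import Data.Bool using (if_then_else_; _∧_)
open import Data.Empty using (⊥-elim)
open import Data.Fin using (Fin; combine; remQuot; _≟_; _<?_)
open import Data.Fin.Patterns using (0F; 1F; 2F)
open import Data.Fin.Permutation using (Permutation′; _⟨$⟩ʳ_; _∘ₚ_; flip; inverseˡ; transpose)
import Data.Fin.Permutation as Perm
open import Data.Fin.Properties using (all?; any?)
open import Data.List using (map; allFin)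
open import Data.List.Properties using (map-cong)
open import Data.Nat using (ℕ; zero; suc; _+_; _≤_; _%_; _≡ᵇ_)
open import Data.Nat.ListAction using (sum)
open import Data.Product using (_×_; _,_; proj₁; proj₂; ∃)
open import Data.Sign using (Sign; _*_) renaming (+ to plus; - to minus)
import Data.Sign.Properties as Signₚ
open import Data.Sum using (_⊎_; inj₁; inj₂)
open import Data.Unit using (tt)
open import Data.Vec using ([]; _∷_; lookup)
open import Function using (_∘_; Injective; case_of_)
open import Function.Bundles using (_⇔_; mk⇔; Injection; Equivalence)
open import Function.Properties.Inverse using (Inverse⇒Injection)
open import Relation.Binary.PropositionalEquality using (_≡_; _≗_; refl; sym; trans; cong; cong₂; module ≡-Reasoning)
open import Relation.Nullary using (¬_; contradiction)
open import Relation.Nullary.Decidable using (toWitness; _×-dec_; _⊎-dec_; ⌊_⌋)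

open import Algebra.Properties.CommutativeSemigroup Signₚ.*-commutativeSemigroup using (interchange)
open import Algebra.Properties.CommutativeMonoid.Sum Signₚ.*-commutativeMonoid
  using (sum-permute; ∑-distrib-+; sum-cong-≗) renaming (sum to ∏)

inversions-cong : ∀ {m} {f g : Fin m → Fin m} → f ≗ g → inversions m f ≡ inversions m g
inversions-cong {m} f≗g = cong sum (map-cong (λ i → cong sum (map-cong (λ j →
    cong₂ (λ x y → if ⌊ i <? j ⌋ ∧ ⌊ x <? y ⌋ then 1 else 0) (f≗g j) (f≗g i)) (allFin m))) (allFin m))

sign-cong : ∀ {m} {f g : Fin m → Fin m} → f ≗ g → sign m f ≡ sign m g
sign-cong f≗g = cong (λ c → if c % 2 ≡ᵇ 0 then plus else minus) (inversions-cong f≗g)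

S₃ : Fin 6 → Fin 3 → Fin 3
S₃ k = lookup (lookup ((0F ∷ 1F ∷ 2F ∷ []) ∷ (0F ∷ 2F ∷ 1F ∷ []) ∷ (1F ∷ 0F ∷ 2F ∷ [])
                     ∷ (1F ∷ 2F ∷ 0F ∷ []) ∷ (2F ∷ 0F ∷ 1F ∷ []) ∷ (2F ∷ 1F ∷ 0F ∷ []) ∷ []) k)

InS₃ : (Fin 3 → Fin 3) → Set
InS₃ f = ∃ λ k → f ≗ S₃ k

triple-classification : ∀ x y z → x ≡ y ⊎ x ≡ z ⊎ y ≡ z ⊎ ∃ λ k → S₃ k 0F ≡ x × S₃ k 1F ≡ y × S₃ k 2F ≡ z
triple-classification = toWitness {a? = all? λ x → all? λ y → all? λ z →
  x ≟ y ⊎-dec x ≟ z ⊎-dec y ≟ z ⊎-dec any? λ k → S₃ k 0F ≟ x ×-dec S₃ k 1F ≟ y ×-dec S₃ k 2F ≟ z} _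

injective-classification : (f : Fin 3 → Fin 3) → Injective _≡_ _≡_ f → InS₃ f
injective-classification f f-inj with triple-classification (f 0F) (f 1F) (f 2F)
... | inj₁ e = contradiction (f-inj e) λ ()
... | inj₂ (inj₁ e) = contradiction (f-inj e) λ ()
... | inj₂ (inj₂ (inj₁ e)) = contradiction (f-inj e) λ ()
... | inj₂ (inj₂ (inj₂ (k , e₀ , e₁ , e₂))) = k , λ { 0F → sym e₀ ; 1F → sym e₁ ; 2F → sym e₂ }

S₃-classification : (π : Permutation′ 3) → InS₃ (π ⟨$⟩ʳ_)
S₃-classification π = injective-classification (π ⟨$⟩ʳ_) (Injection.injective (Inverse⇒Injection π))

sgn : Permutation′ 3 → Sign
sgn π = sign 3 (π ⟨$⟩ʳ_)

sign-∘-S₃ : ∀ k l → sign 3 (S₃ l ∘ S₃ k) ≡ sign 3 (S₃ k) * sign 3 (S₃ l)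
sign-∘-S₃ = toWitness {a? = all? λ k → all? λ l → _ Signₚ.≟ _} _

sign-∘ : ∀ {f g} → InS₃ f → InS₃ g → sign 3 (g ∘ f) ≡ sign 3 f * sign 3 g
sign-∘ {f} {g} (k , f≗) (l , g≗) = begin
  sign 3 (g ∘ f)                  ≡⟨ sign-cong (λ i → trans (cong g (f≗ i)) (g≗ _)) ⟩
  sign 3 (S₃ l ∘ S₃ k)            ≡⟨ sign-∘-S₃ k l ⟩
  sign 3 (S₃ k) * sign 3 (S₃ l)   ≡⟨ cong₂ _*_ (sign-cong f≗) (sign-cong g≗) ⟨
  sign 3 f * sign 3 g             ∎
  where open ≡-Reasoning

sgn-∘ₚ : (π ρ : Permutation′ 3) → sgn (π ∘ₚ ρ) ≡ sgn π * sgn ρ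
sgn-∘ₚ π ρ = sign-∘ (S₃-classification π) (S₃-classification ρ)

sgn-flip : (π : Permutation′ 3) → sgn (flip π) ≡ sgn π
sgn-flip π = Signₚ.*-cancelˡ-≡ (sgn π) _ _ (begin
  sgn π * sgn (flip π)  ≡⟨ sgn-∘ₚ π (flip π) ⟨
  sgn (π ∘ₚ flip π)     ≡⟨ sign-cong {g = λ i → i} (λ _ → inverseˡ π) ⟩
  plus                  ≡⟨ Signₚ.s*s≡+ (sgn π) ⟨
  sgn π * sgn π         ∎)
  where open ≡-Reasoning

wreathMap : (Fin 3 → Fin 3) → (Fin 3 → Fin 3 → Fin 3) → Fin 9 → Fin 9
wreathMap β α x = let (i , j) = remQuot 3 x in combine (β i) (α i j)

wreathMap-cong : ∀ {β β′ α α′} → β ≗ β′ → (∀ i → α i ≗ α′ i) → wreathMap β α ≗ wreathMap β′ α′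
wreathMap-cong β≗ α≗ x = let (i , j) = remQuot 3 x in cong₂ combine (β≗ i) (α≗ i j)

sign-wreathMap-S₃ : ∀ k k₀ k₁ k₂ → let κ = lookup (k₀ ∷ k₁ ∷ k₂ ∷ []) in
  sign 9 (wreathMap (S₃ k) (S₃ ∘ κ)) ≡ sign 3 (S₃ k) * ∏ (sign 3 ∘ S₃ ∘ κ)
sign-wreathMap-S₃ = toWitness {a? = all? λ k → all? λ k₀ → all? λ k₁ → all? λ k₂ → _ Signₚ.≟ _} _

sign-wreathMap : ∀ {β α} → InS₃ β → (∀ i → InS₃ (α i)) →
  sign 9 (wreathMap β α) ≡ sign 3 β * ∏ (λ i → sign 3 (α i))
sign-wreathMap {β} {α} (k , β≗) α∈ = begin
  sign 9 (wreathMap β α)                   ≡⟨ sign-cong (wreathMap-cong β≗ λ i j → trans (α≗ i j) (S₃κ≗ i j)) ⟩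
  sign 9 (wreathMap (S₃ k) (S₃ ∘ κ′))       ≡⟨ sign-wreathMap-S₃ k (κ 0F) (κ 1F) (κ 2F) ⟩
  sign 3 (S₃ k) * ∏ (sign 3 ∘ S₃ ∘ κ′)      ≡⟨ cong₂ _*_ (sign-cong β≗) (sum-cong-≗ (λ i → sign-cong (α≗ i))) ⟨
  sign 3 β * ∏ (λ i → sign 3 (α i))        ∎
  where
  open ≡-Reasoning
  κ = proj₁ ∘ α∈
  α≗ = proj₂ ∘ α∈
  κ′ = lookup (κ 0F ∷ κ 1F ∷ κ 2F ∷ [])
  S₃κ≗ : ∀ i → S₃ (κ i) ≗ S₃ (κ′ i)
  S₃κ≗ 0F _ = refl
  S₃κ≗ 1F _ = refl
  S₃κ≗ 2F _ = refl

wreathSign : ∀ {n} → Aut (suc (suc n)) → Sign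
wreathSign (a , b) = sgn b * ∏ (λ i → sgn (proj₂ (a i)))

sgn₂≡wreathSign : ∀ {n} (σ : Aut (suc (suc n))) → sgn₂ σ ≡ wreathSign σ
sgn₂≡wreathSign (a , b) =
  sign-wreathMap (S₃-classification b) (λ i → S₃-classification (proj₂ (a i)))

wreathSign-· : ∀ {n} (σ τ : Aut (suc (suc n))) → wreathSign (σ · τ) ≡ wreathSign σ * wreathSign τ
wreathSign-· (a , b) (c , d) = begin
  sgn (d ∘ₚ b) * ∏ (λ i → sgn (proj₂ (c i) ∘ₚ proj₂ (a (d ⟨$⟩ʳ i))))
    ≡⟨ cong₂ _*_ (sgn-∘ₚ d b) (sum-cong-≗ λ i → sgn-∘ₚ (proj₂ (c i)) (proj₂ (a (d ⟨$⟩ʳ i)))) ⟩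
  (sgn d * sgn b) * ∏ (λ i → sgn (proj₂ (c i)) * sgn (proj₂ (a (d ⟨$⟩ʳ i))))
    ≡⟨ cong ((sgn d * sgn b) *_) (∑-distrib-+ (sgn ∘ proj₂ ∘ c) (sgn ∘ proj₂ ∘ a ∘ (d ⟨$⟩ʳ_))) ⟩
  (sgn d * sgn b) * (∏ (sgn ∘ proj₂ ∘ c) * ∏ (sgn ∘ proj₂ ∘ a ∘ (d ⟨$⟩ʳ_)))
    ≡⟨ cong (λ x → (sgn d * sgn b) * (∏ (sgn ∘ proj₂ ∘ c) * x)) (sum-permute (sgn ∘ proj₂ ∘ a) d) ⟨
  (sgn d * sgn b) * (∏ (sgn ∘ proj₂ ∘ c) * ∏ (sgn ∘ proj₂ ∘ a))
    ≡⟨ interchange (sgn d) (sgn b) (∏ (sgn ∘ proj₂ ∘ c)) (∏ (sgn ∘ proj₂ ∘ a)) ⟩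
  (sgn d * ∏ (sgn ∘ proj₂ ∘ c)) * (sgn b * ∏ (sgn ∘ proj₂ ∘ a))
    ≡⟨ Signₚ.*-comm (sgn d * ∏ (sgn ∘ proj₂ ∘ c)) (sgn b * ∏ (sgn ∘ proj₂ ∘ a)) ⟩
  (sgn b * ∏ (sgn ∘ proj₂ ∘ a)) * (sgn d * ∏ (sgn ∘ proj₂ ∘ c)) ∎
  where open ≡-Reasoning

wreathSign-inv : ∀ {n} (σ : Aut (suc (suc n))) → wreathSign (inv σ) ≡ wreathSign σ
wreathSign-inv (a , b) = cong₂ _*_ (sgn-flip b) (begin
  ∏ (λ i → sgn (flip (proj₂ (a (flip b ⟨$⟩ʳ i)))))  ≡⟨ sum-cong-≗ (λ i → sgn-flip (proj₂ (a (flip b ⟨$⟩ʳ i)))) ⟩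
  ∏ (sgn ∘ proj₂ ∘ a ∘ (flip b ⟨$⟩ʳ_))              ≡⟨ sum-permute (sgn ∘ proj₂ ∘ a) (flip b) ⟨
  ∏ (sgn ∘ proj₂ ∘ a)                              ∎)
  where open ≡-Reasoning

sgn₂-· : ∀ {n} (σ τ : Aut (suc (suc n))) → sgn₂ (σ · τ) ≡ sgn₂ σ * sgn₂ τ
sgn₂-· σ τ = begin
  sgn₂ (σ · τ)                 ≡⟨ sgn₂≡wreathSign (σ · τ) ⟩
  wreathSign (σ · τ)           ≡⟨ wreathSign-· σ τ ⟩
  wreathSign σ * wreathSign τ  ≡⟨ cong₂ _*_ (sgn₂≡wreathSign σ) (sgn₂≡wreathSign τ) ⟨
  sgn₂ σ * sgn₂ τ              ∎
  where open ≡-Reasoning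

sgn₂-inv : ∀ {n} (σ : Aut (suc (suc n))) → sgn₂ (inv σ) ≡ sgn₂ σ
sgn₂-inv σ = begin
  sgn₂ (inv σ)        ≡⟨ sgn₂≡wreathSign (inv σ) ⟩
  wreathSign (inv σ)  ≡⟨ wreathSign-inv σ ⟩
  wreathSign σ        ≡⟨ sgn₂≡wreathSign σ ⟨
  sgn₂ σ              ∎
  where open ≡-Reasoning

kernel-isNormalSubgroup : ∀ {n} (φ : Aut n → Sign) {H : Aut n → Set} → (∀ σ → H σ ⇔ φ σ ≡ plus) →
  φ idA ≡ plus → (∀ σ τ → φ (σ · τ) ≡ φ σ * φ τ) → (∀ σ → φ (inv σ) ≡ φ σ) → IsNormalSubgroup n H
kernel-isNormalSubgroup φ {H} H⇔ φ-id φ-· φ-inv = record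
  { has-id = from idA φ-id
  ; ·-closed = λ σ τ σ∈H τ∈H → from (σ · τ) (begin
      φ (σ · τ)    ≡⟨ φ-· σ τ ⟩
      φ σ * φ τ    ≡⟨ cong₂ _*_ (to σ σ∈H) (to τ τ∈H) ⟩
      plus         ∎)
  ; inv-closed = λ σ σ∈H → from (inv σ) (trans (φ-inv σ) (to σ σ∈H))
  ; conj-closed = λ g σ σ∈H → from (g · σ · inv g) (begin
      φ (g · σ · inv g)      ≡⟨ φ-· (g · σ) (inv g) ⟩
      φ (g · σ) * φ (inv g)  ≡⟨ cong₂ _*_ (φ-· g σ) (φ-inv g) ⟩
      φ g * φ σ * φ g        ≡⟨ cong (λ s → φ g * s * φ g) (to σ σ∈H) ⟩
      φ g * plus * φ g       ≡⟨ cong (_* φ g) (Signₚ.*-identityʳ (φ g)) ⟩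
      φ g * φ g              ≡⟨ Signₚ.s*s≡+ (φ g) ⟩
      plus                   ∎)
  }
  where
  open ≡-Reasoning
  to = λ σ → Equivalence.to (H⇔ σ)
  from = λ σ → Equivalence.from (H⇔ σ)

E₁-isNormalSubgroup : IsNormalSubgroup 1 (E 1)
E₁-isNormalSubgroup = record
  { has-id = tt ; ·-closed = λ _ _ _ _ → tt ; inv-closed = λ _ _ → tt ; conj-closed = λ _ _ _ → tt }

E₂-isNormalSubgroup : IsNormalSubgroup 2 (E 2)
E₂-isNormalSubgroup =
  kernel-isNormalSubgroup sgn₂ (λ σ → mk⇔ proj₂ ((λ _ → tt) ,_)) refl sgn₂-· sgn₂-inv

record ConjugationCounterexample (n : ℕ) (H : Aut n → Set) : Set where
  field
    g σ : Aut n
    σ∈H : H σ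
    gσg⁻¹∉H : ¬ H (g · σ · inv g)

counterexample⇒¬normal : ∀ {n H} → ConjugationCounterexample n H → ¬ IsNormalSubgroup n H
counterexample⇒¬normal c N = gσg⁻¹∉H (IsNormalSubgroup.conj-closed N g σ σ∈H)
  where open ConjugationCounterexample c

idA∈E : ∀ n → E n idA
idA∈E zero = tt
idA∈E (suc zero) = tt
idA∈E (suc (suc n)) = (λ _ → idA∈E (suc n)) , refl

doubled : ∀ {n} → Aut n → Aut (suc n)
doubled σ = (λ { 0F → σ ; 1F → σ ; 2F → idA }) , Perm.id

atFirst : ∀ {n} → Aut n → Aut (suc n)
atFirst g = (λ { 0F → g ; _ → idA }) , Perm.id

sgn₂-doubled : ∀ {n} (σ : Aut (suc n)) → sgn₂ (doubled σ) ≡ plus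
sgn₂-doubled σ = begin
  sgn₂ (doubled σ)  ≡⟨ sgn₂≡wreathSign (doubled σ) ⟩
  s * (s * plus)    ≡⟨ cong (s *_) (Signₚ.*-identityʳ s) ⟩
  s * s             ≡⟨ Signₚ.s*s≡+ s ⟩
  plus              ∎
  where
  open ≡-Reasoning
  s = sgn (proj₂ σ)

counterexample-suc : ∀ {n} → ConjugationCounterexample (suc n) (E (suc n)) →
  ConjugationCounterexample (suc (suc n)) (E (suc (suc n)))
counterexample-suc {n} c = record
  { g = atFirst g
  ; σ = doubled σ
  ; σ∈H = (λ { 0F → σ∈H ; 1F → σ∈H ; 2F → idA∈E (suc n) }) , sgn₂-doubled σ
  ; gσg⁻¹∉H = λ e → gσg⁻¹∉H (proj₁ e 0F)
  }
  where open ConjugationCounterexample c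

τ : Permutation′ 3
τ = transpose 0F 1F

counterexample₃ : ConjugationCounterexample 3 (E 3)
counterexample₃ = record
  { g = atFirst x
  ; σ = (λ _ → y) , τ
  ; σ∈H = (λ _ → (λ _ → tt) , refl) , refl
  ; gσg⁻¹∉H = λ e → case proj₂ (proj₁ e 0F) of λ ()
  }
  where
  x y : Aut 2
  x = (λ _ → idA) , τ
  y = (λ { 0F → (λ _ → tt) , τ ; _ → idA }) , τ

E-counterexample : ∀ m → ConjugationCounterexample (3 + m) (E (3 + m))
E-counterexample zero = counterexample₃
E-counterexample (suc m) = counterexample-suc (E-counterexample m)

proposition2p3 : (n : ℕ) → 1 ≤ n → (IsNormalSubgroup n (E n) ⇔ (n ≡ 1 ⊎ n ≡ 2))
proposition2p3 1 _ = mk⇔ (λ _ → inj₁ refl) (λ _ → E₁-isNormalSubgroup)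
proposition2p3 2 _ = mk⇔ (λ _ → inj₂ refl) (λ _ → E₂-isNormalSubgroup)
proposition2p3 (suc (suc (suc m))) _ =
  mk⇔ (λ N → ⊥-elim (counterexample⇒¬normal (E-counterexample m) N)) λ { (inj₁ ()) ; (inj₂ ()) }
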